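{- Let $T$ be an odd radial rooted tree with root $v$, fix a lexicographical order $\mathcal{L}$ on the vertices of $T$, and let $v_1,\ldots,v_m$ be the leaves of $T$ listed according to $\mathcal{L}$. Let $T'$ be a rooted tree obtained from $T$ by attaching a non-negative number of new leaves to $v_1$. Then $T'$ has a graceful labeling $f$ with $f(v)=0$ such that $v_1,\ldots,v_m$ is an alternating sequence of vertices under $f$, and the attached leaves form a transferable set of leaves (with respect to this alternating sequence) under $f$.
   Context: A graceful labeling of a tree with $n$ edges is an injective map $f$ from its vertices to $\{0,\ldots,n\}$ whose induced edge labels $|f(x)-f(y)|$ are exactly $\{1,\ldots,n\}$. A lexicographical order on a rooted tree is an ordering of its vertices by increasing depth such that whenever $u$ precedes $w$, all children of $u$ precede all children of $w$. A rooted tree is radial if all leaves are at the same level, and an odd radial rooted tree is a radial rooted tree in which every internal vertex has an odd number of children. Given a gracefully labeled tree, an alternating sequence of vertices is a finite sequence of distinct vertices $v_1,\ldots,v_m$ whose labels are $a,\,b-1,\,a+1,\,b-2,\ldots$ or $a,\,b+1,\,a-1,\,b+2,\ldots$ for some integers $a,b$ (the parameters). A set of leaves adjacent to $v_1$ is transferable (with respect to such a sequence with parameters $a,b$) if their labels are the consecutive integers $c,c+1,\ldots,d$ with $c+d=a+b$. -}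

module Defs where

open import Data.Nat as ℕ using (ℕ; zero; suc; _≤_; ∣_-_∣; _∸_)
open import Data.Fin as Fin using (Fin; _↑ˡ_; _↑ʳ_; splitAt; _≟_)
open import Data.Integer as ℤ using (ℤ; +_)
open import Data.List using (length; filter; allFin)
open import Data.Product using (Σ; ∃; ∃₂; _×_; _,_)
open import Data.Sum using (_⊎_; [_,_]′)
open import Function.Definitions using (Injective)
open import Relation.Binary.PropositionalEquality using (_≡_; _≢_)
open import Relation.Nullary using (¬_; Dec)
open import Relation.Nullary.Decidable using (¬?; _×-dec_)

-- Rooted trees.
-- A rooted (finite) tree is given by its vertex set Fin size, a root,
-- and a parent function (its value at the root is irrelevant).
-- The edges are {x , parent x} for x ≢ root.

record RTree : Set where
  field
    size   : ℕ
    root   : Fin size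
    parent : Fin size → Fin size
open RTree public

IsChild : (T : RTree) → Fin (size T) → Fin (size T) → Set
IsChild T c p = (c ≢ root T) × (parent T c ≡ p)

isChild? : (T : RTree) → (c p : Fin (size T)) → Dec (IsChild T c p)
isChild? T c p = ¬? (c ≟ root T) ×-dec (parent T c ≟ p)

data AtDepth (T : RTree) : Fin (size T) → ℕ → Set where
  at-root : AtDepth T (root T) 0
  at-step : ∀ {x d} → x ≢ root T → AtDepth T (parent T x) d → AtDepth T x (suc d)

-- The parent data really describes a rooted tree: every vertex reaches
-- the root by following parents (connected and acyclic).
IsTree : RTree → Set
IsTree T = ∀ x → ∃ (AtDepth T x)

IsLeaf : (T : RTree) → Fin (size T) → Set
IsLeaf T x = ∀ c → ¬ IsChild T c x

numChildren : (T : RTree) → Fin (size T) → ℕ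
numChildren T x = length (filter (λ c → isChild? T c x) (allFin (size T)))

Odd : ℕ → Set
Odd n = ∃ λ t → n ≡ suc (2 ℕ.* t)

IsRadial : RTree → Set
IsRadial T = ∀ x y dx dy → IsLeaf T x → IsLeaf T y →
             AtDepth T x dx → AtDepth T y dy → dx ≡ dy

IsOddRadial : RTree → Set
IsOddRadial T = IsRadial T × (∀ x → ¬ IsLeaf T x → Odd (numChildren T x))

-- Orders. An ordering of the vertices is given by an injective rank
-- function rk : vertices → positions {0,...,size-1}; u precedes w iff
-- rk u < rk w.

IsLexOrder : (T : RTree) → (Fin (size T) → Fin (size T)) → Set
IsLexOrder T rk =
  Injective _≡_ _≡_ rk
  × (∀ u w du dw → AtDepth T u du → AtDepth T w dw →
       rk u Fin.< rk w → du ≤ dw)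
  × (∀ u w c e → rk u Fin.< rk w → IsChild T c u → IsChild T e w →
       rk c Fin.< rk e)

IsLeafListing : (T : RTree) → (Fin (size T) → Fin (size T)) →
                ∀ {len} → (Fin len → Fin (size T)) → Set
IsLeafListing T rk {len} vs =
  (∀ i → IsLeaf T (vs i))
  × (∀ x → IsLeaf T x → ∃ λ i → vs i ≡ x)
  × (∀ i j → i Fin.< j → rk (vs i) Fin.< rk (vs j))

-- Attaching k new leaves to a vertex u of T.  Old vertices x are
-- x ↑ˡ k, new leaves are size T ↑ʳ j (j : Fin k), all with parent u.

attach : (T : RTree) → Fin (size T) → ℕ → RTree
attach T u k = record
  { size   = size T ℕ.+ k
  ; root   = root T ↑ˡ k
  ; parent = λ x → [ (λ y → parent T y ↑ˡ k) , (λ _ → u ↑ˡ k) ]′ (splitAt (size T) x)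
  }

-- Graceful labelings (tree with size T vertices has size T ∸ 1 edges).

IsGraceful : (T : RTree) → (Fin (size T) → ℕ) → Set
IsGraceful T f =
  Injective _≡_ _≡_ f
  × (∀ x → f x ≤ n)
  × (∀ x → x ≢ root T → 1 ≤ ∣ f x - f (parent T x) ∣ × ∣ f x - f (parent T x) ∣ ≤ n)
  × (∀ l → 1 ≤ l → l ≤ n → ∃ λ x → x ≢ root T × ∣ f x - f (parent T x) ∣ ≡ l)
  where n = size T ∸ 1

-- Alternating sequences.
-- alt a b s i is the i-th term of  a, b-s, a+s, b-2s, a+2s, ...
-- s = 1 gives a, b-1, a+1, b-2, ... ; s = -1 gives a, b+1, a-1, b+2, ...

alt : ℤ → ℤ → ℤ → ℕ → ℤ
alt a b s zero          = a
alt a b s (suc zero)    = b ℤ.- s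
alt a b s (suc (suc i)) = alt (a ℤ.+ s) (b ℤ.- s) s i

IsAlternating : ∀ {N len} → (Fin N → ℕ) → (Fin len → Fin N) → ℤ → ℤ → Set
IsAlternating f w a b =
  Injective _≡_ _≡_ w
  × ((∀ i → + f (w i) ≡ alt a b (ℤ.+ 1) (Fin.toℕ i))
     ⊎ (∀ i → + f (w i) ≡ alt a b (ℤ.- (ℤ.+ 1)) (Fin.toℕ i)))

-- A set of leaves (given as an injective family ls) adjacent to v is
-- transferable w.r.t. parameters a, b: their labels are exactly the
-- consecutive integers c, c+1, ..., d with c + d = a + b.
-- (The empty set is regarded as transferable.)
IsTransferable : (T : RTree) → (Fin (size T) → ℕ) → Fin (size T) →
                 ∀ {k} → (Fin k → Fin (size T)) → ℤ → ℤ → Set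
IsTransferable T f v {k} ls a b =
  Injective _≡_ _≡_ ls
  × (∀ j → IsLeaf T (ls j) × IsChild T (ls j) v)
  × (k ≡ 0 ⊎
     (∃₂ λ c d → c ℤ.≤ d × c ℤ.+ d ≡ a ℤ.+ b
        × (∀ j → c ℤ.≤ + f (ls j) × + f (ls j) ℤ.≤ d)
        × (∀ l → c ℤ.≤ l → l ℤ.≤ d → ∃ λ j → + f (ls j) ≡ l)))

module Submission where

open import Defs
open import Data.Nat using (ℕ; suc; _+_)
open import Data.Fin using (Fin; zero; _↑ˡ_; _↑ʳ_)
open import Data.Product using (∃; ∃₂; _×_; _,_)
open import Relation.Binary.PropositionalEquality using (_≡_)

-- Let T' be T with k new leaves attached to the first leaf vs 0.  Number the
-- vertices of T' by positions 0, ..., n: vertices of T by their rank in the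
-- lexicographical order, then the new leaves.  The graceful labeling is the
-- zigzag labeling of positions, 2h ↦ h and 2h + 1 ↦ n ∸ h (0, n, 1, n ∸ 1, ...).
--
-- It is injective; labels of
--    positions of equal parity 2σ apart differ by σ, those of opposite parity
--    with i + j = 2τ + 1 differ by n ∸ τ; a tail of positions carries a window
--    of consecutive labels; consecutive positions carry an alternating sequence.
--  * EdgeLabels.ParentMap: if the map P sending a position to the position of
--    its parent is below the identity, monotone, grows by at most one per step
--    and only jumps where j + 1 + P (j + 1) is odd, then the edge labels are
--    exactly 1, ..., n (a four-case parity analysis gives injectivity, and an
--    injective self-map of [1, n] is onto: SelfMaps).
--  * BreadthFirst: for an odd radial tree the parent map has these properties.
--    Monotonicity and slow growth come from the lexicographical order; the
--    parity condition from counting the vertices settled by the first i parents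
--    (Counting), every internal vertex having an odd number of children.

module Zigzag where
  open import Data.Bool using (Bool; true; false; if_then_else_)
  open import Data.Nat
  open import Data.Nat.Properties
  open import Data.Integer as ℤ using (ℤ)
  open import Data.Product using (∃; ∃₂; _×_; _,_)
  open import Data.Sum using (_⊎_; inj₁; inj₂)
  open import Relation.Binary.PropositionalEquality
  open import Relation.Nullary using (yes; no)
  open import Relation.Binary.Definitions using (tri<; tri≈; tri>)
  open import Data.Empty using (⊥; ⊥-elim)
  open import Data.Nat.Solver using (module +-*-Solver)
  open +-*-Solver using (solve; _:+_; _:*_; _:=_; con)
  open import Defs using (alt; Odd)

  data ParityView : ℕ → Set where
    even : ∀ h → ParityView (2 * h)
    odd  : ∀ h → ParityView (suc (2 * h))

  2*suc : ∀ h → 2 * suc h ≡ suc (suc (2 * h))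
  2*suc h = cong suc (+-suc h (h + 0))

  parityView : ∀ i → ParityView i
  parityView zero = even 0
  parityView (suc i) with parityView i
  ... | even h = odd h
  ... | odd h  = subst ParityView (2*suc h) (even (suc h))

  isEven : ℕ → Bool
  isEven zero          = true
  isEven (suc zero)    = false
  isEven (suc (suc i)) = isEven i

  -- Applied to the
  -- vertices of a tree in a breadth-first order it is the graceful labeling.
  zigzag : ℕ → ℕ → ℕ
  zigzag n i = if isEven i then ⌊ i /2⌋ else n ∸ ⌊ i /2⌋

  isEven-double : ∀ h → isEven (2 * h) ≡ true
  isEven-double zero = refl
  isEven-double (suc h) = trans (cong isEven (2*suc h)) (isEven-double h)

  isEven-double+1 : ∀ h → isEven (suc (2 * h)) ≡ false
  isEven-double+1 zero = refl
  isEven-double+1 (suc h) = trans (cong (λ x → isEven (suc x)) (2*suc h)) (isEven-double+1 h)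

  ⌊double/2⌋ : ∀ h → ⌊ 2 * h /2⌋ ≡ h
  ⌊double/2⌋ zero = refl
  ⌊double/2⌋ (suc h) = trans (cong ⌊_/2⌋ (2*suc h)) (cong suc (⌊double/2⌋ h))

  ⌊double+1/2⌋ : ∀ h → ⌊ suc (2 * h) /2⌋ ≡ h
  ⌊double+1/2⌋ zero = refl
  ⌊double+1/2⌋ (suc h) = trans (cong (λ x → ⌊ suc x /2⌋) (2*suc h)) (cong suc (⌊double+1/2⌋ h))

  zigzag-even : ∀ n h → zigzag n (2 * h) ≡ h
  zigzag-even n h rewrite isEven-double h = ⌊double/2⌋ h

  zigzag-odd : ∀ n h → zigzag n (suc (2 * h)) ≡ n ∸ h
  zigzag-odd n h rewrite isEven-double+1 h = cong (n ∸_) (⌊double+1/2⌋ h)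

  h≤2h : ∀ h → h ≤ 2 * h
  h≤2h h = m≤m+n h (h + 0)

  h+h≡2h : ∀ h → h + h ≡ 2 * h
  h+h≡2h h = cong (h +_) (sym (+-identityʳ h))

  2[a+b] : ∀ a b → 2 * (a + b) ≡ 2 * a + 2 * b
  2[a+b] a b = *-distribˡ-+ 2 a b

  a+b≤2b : ∀ a b → a ≤ b → a + b ≤ 2 * b
  a+b≤2b a b a≤b = subst (a + b ≤_) (cong (b +_) (sym (+-identityʳ b))) (+-monoˡ-≤ b a≤b)

  [n∸a]∸[n∸b] : ∀ {a b n} → a ≤ b → b ≤ n → (n ∸ a) ∸ (n ∸ b) ≡ b ∸ a
  [n∸a]∸[n∸b] {a} {b} {n} a≤b b≤n = begin
    (n ∸ a) ∸ (n ∸ b)                   ≡⟨ cong (λ x → (x ∸ a) ∸ (n ∸ b)) n≡ ⟩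
    ((b ∸ a) + (n ∸ b) + a) ∸ a ∸ (n ∸ b) ≡⟨ cong (_∸ (n ∸ b)) (m+n∸n≡m (b ∸ a + (n ∸ b)) a) ⟩
    (b ∸ a) + (n ∸ b) ∸ (n ∸ b)          ≡⟨ m+n∸n≡m (b ∸ a) (n ∸ b) ⟩
    b ∸ a                               ∎
    where
    open ≡-Reasoning
    n≡ : n ≡ (b ∸ a) + (n ∸ b) + a
    n≡ = begin
      n                       ≡⟨ sym (m∸n+n≡m b≤n) ⟩
      (n ∸ b) + b             ≡⟨ cong ((n ∸ b) +_) (sym (m∸n+n≡m a≤b)) ⟩
      (n ∸ b) + ((b ∸ a) + a) ≡⟨ sym (+-assoc (n ∸ b) (b ∸ a) a) ⟩
      (n ∸ b) + (b ∸ a) + a   ≡⟨ cong (_+ a) (+-comm (n ∸ b) (b ∸ a)) ⟩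
      (b ∸ a) + (n ∸ b) + a   ∎

  ∣[n∸b]-a∣ : ∀ a b {n} → a + b ≤ n → ∣ (n ∸ b) - a ∣ ≡ n ∸ (a + b)
  ∣[n∸b]-a∣ a b {n} a+b≤n = begin
    ∣ (n ∸ b) - a ∣ ≡⟨ m≤n⇒∣n-m∣≡n∸m (m+n≤o⇒m≤o∸n a a+b≤n) ⟩
    (n ∸ b) ∸ a     ≡⟨ ∸-+-assoc n b a ⟩
    n ∸ (b + a)     ≡⟨ cong (n ∸_) (+-comm b a) ⟩
    n ∸ (a + b)     ∎
    where open ≡-Reasoning

  data Distance (n i j ℓ : ℕ) : Set where
    same-parity     : j ≡ i + 2 * ℓ → Distance n i j ℓ
    opposite-parity : ∀ τ → i + j ≡ suc (2 * τ) → τ < n → ℓ ≡ n ∸ τ → Distance n i j ℓ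

  distance : ∀ {n i j} → i < j → j ≤ n → Distance n i j ∣ zigzag n j - zigzag n i ∣
  distance {n} {i} {j} i<j j≤n with parityView i | parityView j
  ... | even a | even b rewrite zigzag-even n a | zigzag-even n b =
    same-parity (begin
      2 * b                 ≡⟨ cong (2 *_) (sym (m+[n∸m]≡n a≤b)) ⟩
      2 * (a + (b ∸ a))     ≡⟨ 2[a+b] a (b ∸ a) ⟩
      2 * a + 2 * (b ∸ a)   ≡⟨ cong (λ x → 2 * a + 2 * x) (sym (m≤n⇒∣n-m∣≡n∸m a≤b)) ⟩
      2 * a + 2 * ∣ b - a ∣ ∎)
    where
    open ≡-Reasoning
    a≤b : a ≤ b
    a≤b = *-cancelˡ-≤ 2 (<⇒≤ i<j)
  ... | odd a | odd b rewrite zigzag-odd n a | zigzag-odd n b =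
    same-parity (begin
      suc (2 * b)                  ≡⟨ cong (λ x → suc (2 * x)) (sym (m+[n∸m]≡n a≤b)) ⟩
      suc (2 * (a + (b ∸ a)))      ≡⟨ cong suc (2[a+b] a (b ∸ a)) ⟩
      suc (2 * a) + 2 * (b ∸ a)    ≡⟨ cong (λ x → suc (2 * a) + 2 * x) (sym ∣labels∣) ⟩
      suc (2 * a) + 2 * ∣ n ∸ b - n ∸ a ∣ ∎)
    where
    open ≡-Reasoning
    a≤b : a ≤ b
    a≤b = *-cancelˡ-≤ 2 (≤-pred (<⇒≤ i<j))
    b≤n : b ≤ n
    b≤n = ≤-trans (h≤2h b) (≤-trans (n≤1+n _) j≤n)
    ∣labels∣ : ∣ n ∸ b - n ∸ a ∣ ≡ b ∸ a
    ∣labels∣ = trans (m≤n⇒∣m-n∣≡n∸m (∸-monoʳ-≤ n a≤b)) ([n∸a]∸[n∸b] a≤b b≤n)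
  ... | even a | odd b rewrite zigzag-even n a | zigzag-odd n b =
    opposite-parity (a + b) (trans (+-suc (2 * a) (2 * b)) (cong suc (sym (2[a+b] a b))))
      (<-≤-trans (s≤s a+b≤2b') j≤n) (∣[n∸b]-a∣ a b a+b≤n)
    where
    a+b≤2b' : a + b ≤ 2 * b
    a+b≤2b' = a+b≤2b a b (*-cancelˡ-≤ 2 (≤-pred i<j))
    a+b≤n : a + b ≤ n
    a+b≤n = ≤-trans a+b≤2b' (≤-trans (n≤1+n _) j≤n)
  ... | odd a | even b rewrite zigzag-odd n a | zigzag-even n b =
    opposite-parity (a + b) (cong suc (sym (2[a+b] a b)))
      (<-≤-trans (a+b<2b) j≤n)
      (trans (∣-∣-comm b (n ∸ a)) (trans (∣[n∸b]-a∣ b a (subst (_≤ n) (+-comm a b) a+b≤n)) (cong (n ∸_) (+-comm b a))))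
    where
    a+b<2b : a + b < 2 * b
    a+b<2b = a+b≤2b (suc a) b (*-cancelˡ-< 2 a b (≤-trans (n≤1+n _) i<j))
    a+b≤n : a + b ≤ n
    a+b≤n = ≤-trans (<⇒≤ a+b<2b) j≤n

  Distance-range : ∀ {n i j ℓ} → i < j → j ≤ n → Distance n i j ℓ → 1 ≤ ℓ × ℓ ≤ n
  Distance-range {n} {i} {j} {zero} i<j j≤n (same-parity j≡i+0) =
    ⊥-elim (<-irrefl (trans (sym (+-identityʳ i)) (sym j≡i+0)) i<j)
  Distance-range {n} {i} {j} {suc ℓ} i<j j≤n (same-parity j≡i+2ℓ) =
    s≤s z≤n , ≤-trans (h≤2h (suc ℓ)) (≤-trans (m≤n+m _ i) (subst (_≤ n) j≡i+2ℓ j≤n))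
  Distance-range {n} i<j j≤n (opposite-parity τ _ τ<n ℓ≡n∸τ) =
    subst (1 ≤_) (sym ℓ≡n∸τ) (m<n⇒0<n∸m τ<n) , subst (_≤ n) (sym ℓ≡n∸τ) (m∸n≤m n τ)

  zigzag-distance-range : ∀ {n i j} → i < j → j ≤ n →
                          1 ≤ ∣ zigzag n j - zigzag n i ∣ × ∣ zigzag n j - zigzag n i ∣ ≤ n
  zigzag-distance-range i<j j≤n = Distance-range i<j j≤n (distance i<j j≤n)

  zigzag-≤ : ∀ {n i} → i ≤ n → zigzag n i ≤ n
  zigzag-≤ {n} {i} i≤n with parityView i
  ... | even h = subst (_≤ n) (sym (zigzag-even n h)) (≤-trans (h≤2h h) i≤n)
  ... | odd h  = subst (_≤ n) (sym (zigzag-odd n h)) (m∸n≤m n h)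

  collapse : ∀ {n x y} → 1 ≤ ∣ x - y ∣ × ∣ x - y ∣ ≤ n → x ≡ y → ⊥
  collapse (1≤d , _) x≡y = 1+n≰n (subst (1 ≤_) (m≡n⇒∣m-n∣≡0 x≡y) 1≤d)

  zigzag-injective : ∀ {n i j} → i ≤ n → j ≤ n → zigzag n i ≡ zigzag n j → i ≡ j
  zigzag-injective {n} {i} {j} i≤n j≤n eq with <-cmp i j
  ... | tri< i<j _ _ = ⊥-elim (collapse (zigzag-distance-range i<j j≤n) (sym eq))
  ... | tri≈ _ i≡j _ = i≡j
  ... | tri> _ _ j<i = ⊥-elim (collapse (zigzag-distance-range j<i i≤n) eq)

  ≤2*⌈/2⌉ : ∀ q → q ≤ 2 * ⌈ q /2⌉
  ≤2*⌈/2⌉ q with parityView q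
  ... | even t = *-monoʳ-≤ 2 (≤-reflexive (sym (⌊double+1/2⌋ t)))
  ... | odd t  = subst (suc (2 * t) ≤_) (cong (2 *_) (cong suc (sym (⌊double/2⌋ t))))
                   (subst (suc (2 * t) ≤_) (sym (2*suc t)) (n≤1+n _))

  ≤1+2*⌊/2⌋ : ∀ q → q ≤ suc (2 * ⌊ q /2⌋)
  ≤1+2*⌊/2⌋ q with parityView q
  ... | even t = subst (λ x → 2 * t ≤ suc (2 * x)) (sym (⌊double/2⌋ t)) (n≤1+n _)
  ... | odd t  = subst (λ x → suc (2 * t) ≤ suc (2 * x)) (sym (⌊double+1/2⌋ t)) ≤-refl

  zigzag-tail-range : ∀ {n q₀ q} → q₀ ≤ q → q ≤ n →
                      ⌈ q₀ /2⌉ ≤ zigzag n q × zigzag n q ≤ n ∸ ⌊ q₀ /2⌋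
  zigzag-tail-range {n} {q₀} {q} q₀≤q q≤n with parityView q
  ... | even t rewrite zigzag-even n t =
    subst (⌈ q₀ /2⌉ ≤_) (⌊double+1/2⌋ t) (⌈n/2⌉-mono q₀≤q) ,
    m+n≤o⇒m≤o∸n t (≤-trans (+-monoʳ-≤ t ⌊q₀/2⌋≤t) (subst (_≤ n) (sym (h+h≡2h t)) q≤n))
    where
    ⌊q₀/2⌋≤t : ⌊ q₀ /2⌋ ≤ t
    ⌊q₀/2⌋≤t = subst (⌊ q₀ /2⌋ ≤_) (⌊double/2⌋ t) (⌊n/2⌋-mono q₀≤q)
  ... | odd t rewrite zigzag-odd n t =
    ≤-trans (subst (⌈ q₀ /2⌉ ≤_) (cong suc (⌊double/2⌋ t)) (⌈n/2⌉-mono q₀≤q))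
            (m+n≤o⇒m≤o∸n (suc t) (subst (_≤ n) (cong suc (sym (h+h≡2h t))) q≤n)) ,
    ∸-monoʳ-≤ n (subst (⌊ q₀ /2⌋ ≤_) (⌊double+1/2⌋ t) (⌊n/2⌋-mono q₀≤q))

  zigzag-tail-onto : ∀ {n q₀ l} → q₀ ≤ n → ⌈ q₀ /2⌉ ≤ l → l ≤ n ∸ ⌊ q₀ /2⌋ →
                     ∃ λ q → q₀ ≤ q × q ≤ n × zigzag n q ≡ l
  zigzag-tail-onto {n} {q₀} {l} q₀≤n lo hi with 2 * l ≤? n
  ... | yes 2l≤n = 2 * l , ≤-trans (≤2*⌈/2⌉ q₀) (*-monoʳ-≤ 2 lo) , 2l≤n , zigzag-even n l
  ... | no 2l≰n =
    suc (2 * r) , ≤-trans (≤1+2*⌊/2⌋ q₀) (s≤s (*-monoʳ-≤ 2 ⌊q₀/2⌋≤r)) , 2r<n ,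
    trans (zigzag-odd n r) (m∸[m∸n]≡n l≤n)
    where
    r : ℕ
    r = n ∸ l
    l≤n : l ≤ n
    l≤n = ≤-trans hi (m∸n≤m n ⌊ q₀ /2⌋)
    ⌊q₀/2⌋≤r : ⌊ q₀ /2⌋ ≤ r
    ⌊q₀/2⌋≤r = m+n≤o⇒m≤o∸n ⌊ q₀ /2⌋
      (subst (_≤ n) (+-comm l _) (m≤o∸n⇒m+n≤o l (≤-trans (⌊n/2⌋≤n q₀) q₀≤n) hi))
    r+l≡n : r + l ≡ n
    r+l≡n = m∸n+n≡m l≤n
    r<l : r < l
    r<l = +-cancelʳ-< l r l (subst (_< l + l) (sym r+l≡n) (subst (n <_) (sym (h+h≡2h l)) (≰⇒> 2l≰n)))
    2r<n : suc (2 * r) ≤ n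
    2r<n = subst (suc (2 * r) ≤_) r+l≡n (subst (λ x → suc x ≤ r + l) (h+h≡2h r) (+-monoʳ-< r r<l))

  n∸h≡1+n∸[1+h] : ∀ {n h} → h < n → n ∸ h ≡ suc (n ∸ suc h)
  n∸h≡1+n∸[1+h] {suc n} {zero}  _         = refl
  n∸h≡1+n∸[1+h] {suc n} {suc h} (s≤s h<n) = n∸h≡1+n∸[1+h] h<n

  alternation-even : ∀ n h i → 2 * h + i ≤ n →
                     ℤ.+ zigzag n (2 * h + i) ≡ alt (ℤ.+ h) (ℤ.+ suc (n ∸ h)) (ℤ.+ 1) i
  alternation-even n h zero _ = cong ℤ.+_ (trans (cong (zigzag n) (+-identityʳ (2 * h))) (zigzag-even n h))
  alternation-even n h (suc zero) _ = cong ℤ.+_ (trans (cong (zigzag n) (+-comm (2 * h) 1)) (zigzag-odd n h))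
  alternation-even n h (suc (suc i)) 2h+i+2≤n = begin
    ℤ.+ zigzag n (2 * h + suc (suc i))
      ≡⟨ cong (λ x → ℤ.+ zigzag n x) shift ⟩
    ℤ.+ zigzag n (2 * suc h + i)
      ≡⟨ alternation-even n (suc h) i (subst (_≤ n) shift 2h+i+2≤n) ⟩
    alt (ℤ.+ suc h) (ℤ.+ suc (n ∸ suc h)) (ℤ.+ 1) i
      ≡⟨ cong₂ (λ a b → alt (ℤ.+ a) (ℤ.+ b) (ℤ.+ 1) i) (+-comm 1 h) (sym (n∸h≡1+n∸[1+h] h<n)) ⟩
    alt (ℤ.+ (h + 1)) (ℤ.+ (n ∸ h)) (ℤ.+ 1) i ∎
    where
    open ≡-Reasoning
    shift : 2 * h + suc (suc i) ≡ 2 * suc h + i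
    shift = trans (+-suc (2 * h) (suc i)) (trans (cong suc (+-suc (2 * h) i)) (cong (_+ i) (sym (2*suc h))))
    h<n : h < n
    h<n = ≤-trans (s≤s (≤-trans (h≤2h h) (m≤m+n (2 * h) (suc i)))) (subst (_≤ n) (+-suc (2 * h) (suc i)) 2h+i+2≤n)

  alternation-odd : ∀ n h i → suc (2 * h) + i ≤ n →
                    ℤ.+ zigzag n (suc (2 * h) + i) ≡ alt (ℤ.+ (n ∸ h)) (ℤ.+ h) (ℤ.- ℤ.+ 1) i
  alternation-odd n h zero _ = cong ℤ.+_ (trans (cong (λ x → zigzag n (suc x)) (+-identityʳ (2 * h))) (zigzag-odd n h))
  alternation-odd n h (suc zero) _ =
    cong ℤ.+_ (trans (cong (zigzag n) (trans (+-comm (suc (2 * h)) 1) (sym (2*suc h))))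
                     (trans (zigzag-even n (suc h)) (+-comm 1 h)))
  alternation-odd n h (suc (suc i)) 2h+i+3≤n = begin
    ℤ.+ zigzag n (suc (2 * h) + suc (suc i))
      ≡⟨ cong (λ x → ℤ.+ zigzag n x) shift ⟩
    ℤ.+ zigzag n (suc (2 * suc h) + i)
      ≡⟨ alternation-odd n (suc h) i (subst (_≤ n) shift 2h+i+3≤n) ⟩
    alt (ℤ.+ (n ∸ suc h)) (ℤ.+ suc h) (ℤ.- ℤ.+ 1) i
      ≡⟨ cong₂ (λ a b → alt a (ℤ.+ b) (ℤ.- ℤ.+ 1) i)
               (cong (λ x → ℤ.+ x ℤ.+ ℤ.- ℤ.+ 1) (sym (n∸h≡1+n∸[1+h] h<n))) (+-comm 1 h) ⟩
    alt (ℤ.+ (n ∸ h) ℤ.+ ℤ.- ℤ.+ 1) (ℤ.+ (h + 1)) (ℤ.- ℤ.+ 1) i ∎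
    where
    open ≡-Reasoning
    shift : suc (2 * h) + suc (suc i) ≡ suc (2 * suc h + i)
    shift = cong suc (trans (+-suc (2 * h) (suc i)) (trans (cong suc (+-suc (2 * h) i)) (cong (_+ i) (sym (2*suc h)))))
    h<n : h < n
    h<n = ≤-trans (s≤s (≤-trans (h≤2h h) (m≤m+n (2 * h) (suc (suc i))))) 2h+i+3≤n

  AlternatingFrom : ℕ → ℕ → ℤ → ℤ → Set
  AlternatingFrom n p a b =
    (∀ i → p + i ≤ n → ℤ.+ zigzag n (p + i) ≡ alt a b (ℤ.+ 1) i) ⊎
    (∀ i → p + i ≤ n → ℤ.+ zigzag n (p + i) ≡ alt a b (ℤ.- ℤ.+ 1) i)

  window-sum-odd : ∀ n u → u ≤ n → ⌈ suc (2 * u) /2⌉ + (n ∸ ⌊ suc (2 * u) /2⌋) ≡ suc n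
  window-sum-odd n u u≤n = begin
    suc ⌊ 2 * u /2⌋ + (n ∸ ⌊ suc (2 * u) /2⌋) ≡⟨ cong₂ (λ x y → suc x + (n ∸ y)) (⌊double/2⌋ u) (⌊double+1/2⌋ u) ⟩
    suc u + (n ∸ u)                           ≡⟨ cong suc (m+[n∸m]≡n u≤n) ⟩
    suc n                                     ∎
    where open ≡-Reasoning

  window-sum-even : ∀ n u → u ≤ n → ⌈ 2 * u /2⌉ + (n ∸ ⌊ 2 * u /2⌋) ≡ n
  window-sum-even n u u≤n = begin
    ⌊ suc (2 * u) /2⌋ + (n ∸ ⌊ 2 * u /2⌋) ≡⟨ cong₂ (λ x y → x + (n ∸ y)) (⌊double+1/2⌋ u) (⌊double/2⌋ u) ⟩
    u + (n ∸ u)                           ≡⟨ m+[n∸m]≡n u≤n ⟩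
    n                                     ∎
    where open ≡-Reasoning

  odd+odd≡even : ∀ u h → suc (2 * u) + suc (2 * h) ≡ 2 * suc (u + h)
  odd+odd≡even = solve 2 (λ u h → (con 1 :+ con 2 :* u) :+ (con 1 :+ con 2 :* h) := con 2 :* (con 1 :+ (u :+ h))) refl

  zigzag-alternates : ∀ n p → p ≤ n → ∃₂ λ a b → AlternatingFrom n p a b ×
    (∀ q₀ → Odd (q₀ + p) → q₀ ≤ n → a ℤ.+ b ≡ ℤ.+ (⌈ q₀ /2⌉ + (n ∸ ⌊ q₀ /2⌋)))
  zigzag-alternates n p p≤n with parityView p
  ... | even h = ℤ.+ h , ℤ.+ suc (n ∸ h) , inj₁ (alternation-even n h) , window-sum
    where
    window-sum : ∀ q₀ → Odd (q₀ + 2 * h) → q₀ ≤ n → ℤ.+ (h + suc (n ∸ h)) ≡ ℤ.+ (⌈ q₀ /2⌉ + (n ∸ ⌊ q₀ /2⌋))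
    window-sum q₀ (t , odd-sum) q₀≤n with parityView q₀
    ... | even u = ⊥-elim (even≢odd (u + h) t (trans (2[a+b] u h) odd-sum))
    ... | odd u  = cong ℤ.+_ (trans (trans (+-suc h (n ∸ h)) (cong suc (m+[n∸m]≡n (≤-trans (h≤2h h) p≤n))))
                                    (sym (window-sum-odd n u (≤-trans (h≤2h u) (≤-trans (n≤1+n _) q₀≤n)))))
  ... | odd h = ℤ.+ (n ∸ h) , ℤ.+ h , inj₂ (alternation-odd n h) , window-sum
    where
    window-sum : ∀ q₀ → Odd (q₀ + suc (2 * h)) → q₀ ≤ n → ℤ.+ (n ∸ h + h) ≡ ℤ.+ (⌈ q₀ /2⌉ + (n ∸ ⌊ q₀ /2⌋))
    window-sum q₀ (t , odd-sum) q₀≤n with parityView q₀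
    ... | odd u  = ⊥-elim (even≢odd (suc (u + h)) t (trans (sym (odd+odd≡even u h)) odd-sum))
    ... | even u = cong ℤ.+_ (trans (m∸n+n≡m (≤-trans (h≤2h h) (≤-trans (n≤1+n _) p≤n)))
                                    (sym (window-sum-even n u (≤-trans (h≤2h u) q₀≤n))))

module SelfMaps where
  open import Data.Nat
  open import Data.Nat.Properties
  open import Data.Fin as Fin using (Fin; toℕ; fromℕ<; punchOut)
  open import Data.Fin.Properties using (any?; punchOut-injective; injective⇒≤; toℕ-injective; toℕ-fromℕ<; toℕ<n)
  open import Data.Product using (∃; _×_; _,_; proj₁; proj₂)
  open import Data.Empty using (⊥-elim)
  open import Function.Definitions using (Injective)
  open import Relation.Binary.PropositionalEquality
  open import Relation.Nullary using (yes; no)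

  -- An injective self-map of a finite set is onto (it cannot miss a point y,
  -- since it would then inject Fin (suc n) into Fin n).
  injective⇒onto : ∀ {n} (f : Fin n → Fin n) → Injective _≡_ _≡_ f → ∀ y → ∃ λ x → f x ≡ y
  injective⇒onto {suc n} f f-inj y with any? (λ x → f x Fin.≟ y)
  ... | yes hit = hit
  ... | no miss = ⊥-elim (1+n≰n (injective⇒≤ {f = f∖y} f∖y-injective))
    where
    y≢f : ∀ x → y ≢ f x
    y≢f x y≡fx = miss (x , sym y≡fx)
    f∖y : Fin (suc n) → Fin n
    f∖y x = punchOut (y≢f x)
    f∖y-injective : Injective _≡_ _≡_ f∖y
    f∖y-injective {a} {b} eq = f-inj (punchOut-injective (y≢f a) (y≢f b) eq)

  -- The same for self-maps of the interval [1, n] of natural numbers,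
  -- transported along the bijection Fin n ≅ [1, n], x ↦ 1 + x.
  module _ (n : ℕ) (L : ℕ → ℕ)
    (into : ∀ j → 1 ≤ j → j ≤ n → 1 ≤ L j × L j ≤ n)
    (inj : ∀ j j' → 1 ≤ j → j ≤ n → 1 ≤ j' → j' ≤ n → L j ≡ L j' → j ≡ j') where

    private
      L-in : ∀ (x : Fin n) → 1 ≤ L (suc (toℕ x)) × L (suc (toℕ x)) ≤ n
      L-in x = into (suc (toℕ x)) (s≤s z≤n) (toℕ<n x)

      pred-L : ∀ (x : Fin n) → ∃ λ l → L (suc (toℕ x)) ≡ suc l
      pred-L x with L (suc (toℕ x)) | proj₁ (L-in x)
      ... | suc l | _ = l , refl

      f : Fin n → Fin n
      f x = fromℕ< (subst (_≤ n) (proj₂ (pred-L x)) (proj₂ (L-in x)))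

      toℕ-f : ∀ x → suc (toℕ (f x)) ≡ L (suc (toℕ x))
      toℕ-f x = trans (cong suc (toℕ-fromℕ< _)) (sym (proj₂ (pred-L x)))

      f-injective : Injective _≡_ _≡_ f
      f-injective {a} {b} fa≡fb = toℕ-injective (suc-injective
        (inj _ _ (s≤s z≤n) (toℕ<n a) (s≤s z≤n) (toℕ<n b)
          (trans (sym (toℕ-f a)) (trans (cong (λ y → suc (toℕ y)) fa≡fb) (toℕ-f b)))))

    interval-onto : ∀ l → 1 ≤ l → l ≤ n → ∃ λ j → 1 ≤ j × j ≤ n × L j ≡ l
    interval-onto (suc l) _ l<n with injective⇒onto f f-injective (fromℕ< l<n)
    ... | x , fx≡l = suc (toℕ x) , s≤s z≤n , toℕ<n x ,
      trans (sym (toℕ-f x)) (cong suc (trans (cong toℕ fx≡l) (toℕ-fromℕ< l<n)))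

module EdgeLabels where
  open import Data.Nat
  open import Data.Nat.Properties
  open import Data.Product using (∃; _×_; _,_; proj₁; proj₂)
  open import Data.Empty using (⊥; ⊥-elim)
  open import Relation.Binary.PropositionalEquality
  open import Relation.Binary.Definitions using (tri<; tri≈; tri>)
  open import Defs using (Odd)
  open import Data.Nat.Solver using (module +-*-Solver)
  open +-*-Solver using (solve; _:+_; _:*_; _:=_; con)
  open Zigzag
  open SelfMaps using (interval-onto)

  double-sum : ∀ x ℓ → x + 2 * ℓ + x ≡ 2 * (x + ℓ)
  double-sum = solve 2 (λ x ℓ → x :+ con 2 :* ℓ :+ x := con 2 :* (x :+ ℓ)) refl

  even+odd : ∀ ℓ τ → 2 * ℓ + suc (2 * τ) ≡ suc (2 * (ℓ + τ))
  even+odd = solve 2 (λ ℓ τ → con 2 :* ℓ :+ (con 1 :+ con 2 :* τ) := con 1 :+ con 2 :* (ℓ :+ τ)) refl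

  odd+shift : ∀ τ x ℓ → suc (2 * τ) + (x + 2 * ℓ) ≡ x + suc (2 * (τ + ℓ))
  odd+shift = solve 3 (λ τ x ℓ → (con 1 :+ con 2 :* τ) :+ (x :+ con 2 :* ℓ) := x :+ (con 1 :+ con 2 :* (τ :+ ℓ))) refl

  -- P j is the position of the parent of the vertex at
  -- position j (1 ≤ j ≤ n).
  module ParentMap (n : ℕ) (P : ℕ → ℕ)
    (below      : ∀ j → 1 ≤ j → j ≤ n → P j < j)
    (monotone   : ∀ j j' → 1 ≤ j → j ≤ j' → j' ≤ n → P j ≤ P j')
    (slow       : ∀ j → 1 ≤ j → suc j ≤ n → P (suc j) ≤ suc (P j))
    (jumpParity : ∀ j → 1 ≤ j → suc j ≤ n → P j < P (suc j) → Odd (suc j + P (suc j)))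
    where

    edgeLabel : ℕ → ℕ
    edgeLabel j = ∣ zigzag n j - zigzag n (P j) ∣

    edgeLabel-range : ∀ j → 1 ≤ j → j ≤ n → 1 ≤ edgeLabel j × edgeLabel j ≤ n
    edgeLabel-range j 1≤j j≤n = zigzag-distance-range (below j 1≤j j≤n) j≤n

    shape : ∀ j → 1 ≤ j → j ≤ n → Distance n (P j) j (edgeLabel j)
    shape j 1≤j j≤n = distance (below j 1≤j j≤n) j≤n

    lag : ∀ j d → 1 ≤ j → j + d ≤ n → j + P (j + d) ≤ (j + d) + P j
    lag j zero _ _ = ≤-reflexive (trans (cong (λ x → j + P x) (+-identityʳ j)) (cong (_+ P j) (sym (+-identityʳ j))))
    lag j (suc d) 1≤j j+d+1≤n = begin
      j + P (j + suc d)     ≡⟨ cong (λ x → j + P x) (+-suc j d) ⟩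
      j + P (suc (j + d))   ≤⟨ +-monoʳ-≤ j (slow (j + d) (≤-trans 1≤j (m≤m+n j d)) j+d+1≤n') ⟩
      j + suc (P (j + d))   ≡⟨ +-suc j (P (j + d)) ⟩
      suc (j + P (j + d))   ≤⟨ s≤s (lag j d 1≤j (≤-trans (n≤1+n _) j+d+1≤n')) ⟩
      suc (j + d + P j)     ≡⟨ cong (_+ P j) (sym (+-suc j d)) ⟩
      j + suc d + P j       ∎
      where
      open ≤-Reasoning
      j+d+1≤n' : suc (j + d) ≤ n
      j+d+1≤n' = subst (_≤ n) (+-suc j d) j+d+1≤n

    lag≤ : ∀ j j' → 1 ≤ j → j ≤ j' → j' ≤ n → j + P j' ≤ j' + P j
    lag≤ j j' 1≤j j≤j' j'≤n with m≤n⇒∃[o]m+o≡n j≤j'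
    ... | d , refl = lag j d 1≤j j'≤n

    same-same : ∀ {ℓ} j q → 1 ≤ j → j ≤ q → suc q ≤ n →
                j ≡ P j + 2 * ℓ → suc q ≡ P (suc q) + 2 * ℓ → ⊥
    same-same {ℓ} j q 1≤j j≤q q<n j≡ q+1≡ = even≢odd (P (suc q) + ℓ) t (trans (sym sum-even) sum-odd)
      where
      2ℓ+Pq≤q : 2 * ℓ + P q ≤ q
      2ℓ+Pq≤q = +-cancelˡ-≤ (P j) _ _ (subst₂ _≤_
        (trans (cong (_+ P q) j≡) (+-assoc (P j) (2 * ℓ) (P q))) (+-comm q (P j))
        (lag≤ j q 1≤j j≤q (≤-trans (n≤1+n q) q<n)))
      jump : P q < P (suc q)
      jump = +-cancelˡ-≤ (2 * ℓ) _ _ (subst (2 * ℓ + suc (P q) ≤_)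
        (trans q+1≡ (+-comm (P (suc q)) (2 * ℓ)))
        (subst (_≤ suc q) (sym (+-suc (2 * ℓ) (P q))) (s≤s 2ℓ+Pq≤q)))
      t : ℕ
      t = proj₁ (jumpParity q (≤-trans 1≤j j≤q) q<n jump)
      sum-odd : suc q + P (suc q) ≡ suc (2 * t)
      sum-odd = proj₂ (jumpParity q (≤-trans 1≤j j≤q) q<n jump)
      sum-even : suc q + P (suc q) ≡ 2 * (P (suc q) + ℓ)
      sum-even = trans (cong (_+ P (suc q)) q+1≡) (double-sum (P (suc q)) ℓ)

    opposite-opposite : ∀ {ℓ} j j' τ τ' → 1 ≤ j → j < j' → j' ≤ n →
                        P j + j ≡ suc (2 * τ) → τ < n → ℓ ≡ n ∸ τ →
                        P j' + j' ≡ suc (2 * τ') → τ' < n → ℓ ≡ n ∸ τ' → ⊥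
    opposite-opposite j j' τ τ' 1≤j j<j' j'≤n sum≡ τ<n ℓ≡ sum'≡ τ'<n ℓ≡' =
      <-irrefl (trans sum≡ (trans (cong (λ x → suc (2 * x)) τ≡τ') (sym sum'≡)))
               (+-mono-≤-< (monotone j j' 1≤j (<⇒≤ j<j') j'≤n) j<j')
      where
      τ≡τ' : τ ≡ τ'
      τ≡τ' = ∸-cancelˡ-≡ (<⇒≤ τ<n) (<⇒≤ τ'<n) (trans (sym ℓ≡) ℓ≡')

    same-opposite : ∀ {ℓ} j j' τ' → 1 ≤ j → j < j' → j' ≤ n →
                    j ≡ P j + 2 * ℓ → P j' + j' ≡ suc (2 * τ') → τ' < n → ℓ ≡ n ∸ τ' → ⊥
    same-opposite {ℓ} j j' τ' 1≤j j<j' j'≤n j≡ sum'≡ τ'<n ℓ≡ = 1+n≰n (begin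
      suc (2 * n)            ≡⟨ cong (λ x → suc (2 * x)) (sym ℓ+τ'≡n) ⟩
      suc (2 * (ℓ + τ'))     ≡⟨ sym (even+odd ℓ τ') ⟩
      2 * ℓ + suc (2 * τ')   ≡⟨ cong (2 * ℓ +_) (sym sum'≡) ⟩
      2 * ℓ + (P j' + j')    ≡⟨ sym (+-assoc (2 * ℓ) (P j') j') ⟩
      2 * ℓ + P j' + j'      ≤⟨ +-mono-≤ 2ℓ+Pj'≤j' ≤-refl ⟩
      j' + j'                ≤⟨ +-mono-≤ j'≤n j'≤n ⟩
      n + n                  ≡⟨ h+h≡2h n ⟩
      2 * n                  ∎)
      where
      open ≤-Reasoning
      ℓ+τ'≡n : ℓ + τ' ≡ n
      ℓ+τ'≡n = trans (cong (_+ τ') ℓ≡) (m∸n+n≡m (<⇒≤ τ'<n))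
      2ℓ+Pj'≤j' : 2 * ℓ + P j' ≤ j'
      2ℓ+Pj'≤j' = +-cancelˡ-≤ (P j) _ _ (subst₂ _≤_
        (trans (cong (_+ P j') j≡) (+-assoc (P j) (2 * ℓ) (P j'))) (+-comm j' (P j))
        (lag≤ j j' 1≤j (<⇒≤ j<j') j'≤n))

    opposite-same : ∀ {ℓ} j j' τ → 1 ≤ j → j < j' → j' ≤ n →
                    P j + j ≡ suc (2 * τ) → τ < n → ℓ ≡ n ∸ τ → j' ≡ P j' + 2 * ℓ → ⊥
    opposite-same {ℓ} j j' τ 1≤j j<j' j'≤n sum≡ τ<n ℓ≡ j'≡ = <-irrefl too-big (begin-strict
      P j + j + j'           ≡⟨ +-assoc (P j) j j' ⟩
      P j + (j + j')         <⟨ +-mono-≤-< (monotone j j' 1≤j (<⇒≤ j<j') j'≤n)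
                                            (+-mono-<-≤ (<-≤-trans j<j' j'≤n) j'≤n) ⟩
      P j' + (n + n)         <⟨ +-monoʳ-< (P j') (n<1+n (n + n)) ⟩
      P j' + suc (n + n)     ∎)
      where
      open ≤-Reasoning
      τ+ℓ≡n : τ + ℓ ≡ n
      τ+ℓ≡n = trans (cong (τ +_) ℓ≡) (m+[n∸m]≡n (<⇒≤ τ<n))
      too-big : P j + j + j' ≡ P j' + suc (n + n)
      too-big = begin-equality
        P j + j + j'                 ≡⟨ cong₂ _+_ sum≡ j'≡ ⟩
        suc (2 * τ) + (P j' + 2 * ℓ) ≡⟨ odd+shift τ (P j') ℓ ⟩
        P j' + suc (2 * (τ + ℓ))     ≡⟨ cong (λ x → P j' + suc (2 * x)) τ+ℓ≡n ⟩
        P j' + suc (2 * n)           ≡⟨ cong (λ x → P j' + suc x) (sym (h+h≡2h n)) ⟩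
        P j' + suc (n + n)           ∎

    distinct : ∀ j j' → 1 ≤ j → j < j' → j' ≤ n → edgeLabel j ≢ edgeLabel j'
    distinct j (suc q) 1≤j j<q+1 q+1≤n same-label =
      clash (shape j 1≤j j≤n) (subst (Distance n (P (suc q)) (suc q)) (sym same-label) (shape (suc q) (s≤s z≤n) q+1≤n))
      where
      j≤n : j ≤ n
      j≤n = ≤-trans (<⇒≤ j<q+1) q+1≤n
      clash : ∀ {ℓ} → Distance n (P j) j ℓ → Distance n (P (suc q)) (suc q) ℓ → ⊥
      clash {ℓ} (same-parity j≡) (same-parity q+1≡) = same-same {ℓ} j q 1≤j (≤-pred j<q+1) q+1≤n j≡ q+1≡
      clash (same-parity j≡) (opposite-parity τ' sum'≡ τ'<n ℓ≡') =
        same-opposite j (suc q) τ' 1≤j j<q+1 q+1≤n j≡ sum'≡ τ'<n ℓ≡'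
      clash (opposite-parity τ sum≡ τ<n ℓ≡) (same-parity q+1≡) =
        opposite-same j (suc q) τ 1≤j j<q+1 q+1≤n sum≡ τ<n ℓ≡ q+1≡
      clash (opposite-parity τ sum≡ τ<n ℓ≡) (opposite-parity τ' sum'≡ τ'<n ℓ≡') =
        opposite-opposite j (suc q) τ τ' 1≤j j<q+1 q+1≤n sum≡ τ<n ℓ≡ sum'≡ τ'<n ℓ≡'

    edgeLabel-injective : ∀ j j' → 1 ≤ j → j ≤ n → 1 ≤ j' → j' ≤ n → edgeLabel j ≡ edgeLabel j' → j ≡ j'
    edgeLabel-injective j j' 1≤j j≤n 1≤j' j'≤n same-label with <-cmp j j'
    ... | tri< j<j' _ _ = ⊥-elim (distinct j j' 1≤j j<j' j'≤n same-label)
    ... | tri≈ _ j≡j' _ = j≡j'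
    ... | tri> _ _ j'<j = ⊥-elim (distinct j' j 1≤j' j'<j j≤n (sym same-label))

    edgeLabel-onto : ∀ l → 1 ≤ l → l ≤ n → ∃ λ j → 1 ≤ j × j ≤ n × edgeLabel j ≡ l
    edgeLabel-onto = interval-onto n edgeLabel edgeLabel-range edgeLabel-injective

module Counting where
  open import Data.Nat
  open import Data.Nat.Properties using (+-suc)
  open import Data.Fin using (Fin; zero; suc)
  open import Data.Fin.Properties using (0≢1+n; suc-injective)
  open import Data.List using (length; filter; tabulate)
  open import Data.Sum using (_⊎_; [_,_]′)
  open import Data.Empty using (⊥-elim)
  open import Relation.Binary.PropositionalEquality
  open import Relation.Nullary using (¬_; yes; no)
  open import Relation.Unary using (Pred; Decidable)
  open import Level using (0ℓ)

  count : ∀ {N} {A : Pred (Fin N) 0ℓ} → Decidable A → ℕ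
  count {zero}  A? = 0
  count {suc N} A? with A? zero
  ... | yes _ = suc (count (λ x → A? (suc x)))
  ... | no _  = count (λ x → A? (suc x))

  length-filter-tabulate : ∀ {N M} {A : Pred (Fin M) 0ℓ} (A? : Decidable A) (f : Fin N → Fin M) →
                           length (filter A? (tabulate f)) ≡ count (λ x → A? (f x))
  length-filter-tabulate {zero}  A? f = refl
  length-filter-tabulate {suc N} A? f with A? (f zero)
  ... | yes _ = cong suc (length-filter-tabulate A? (λ x → f (suc x)))
  ... | no _  = length-filter-tabulate A? (λ x → f (suc x))

  count-cong : ∀ {N} {A B : Pred (Fin N) 0ℓ} (A? : Decidable A) (B? : Decidable B) →
               (∀ x → A x → B x) → (∀ x → B x → A x) → count A? ≡ count B?
  count-cong {zero}  A? B? A⇒B B⇒A = refl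
  count-cong {suc N} A? B? A⇒B B⇒A with A? zero | B? zero
  ... | yes _ | yes _ = cong suc (count-cong _ _ (λ x → A⇒B (suc x)) (λ x → B⇒A (suc x)))
  ... | no _  | no _  = count-cong _ _ (λ x → A⇒B (suc x)) (λ x → B⇒A (suc x))
  ... | yes a | no ¬b = ⊥-elim (¬b (A⇒B zero a))
  ... | no ¬a | yes b = ⊥-elim (¬a (B⇒A zero b))

  count-disjoint-union : ∀ {N} {A B C : Pred (Fin N) 0ℓ}
    (A? : Decidable A) (B? : Decidable B) (C? : Decidable C) →
    (∀ x → C x → A x ⊎ B x) → (∀ x → A x → C x) → (∀ x → B x → C x) →
    (∀ x → A x → ¬ B x) → count C? ≡ count A? + count B?
  count-disjoint-union {zero} A? B? C? C⇒A⊎B A⇒C B⇒C disjoint = refl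
  count-disjoint-union {suc N} A? B? C? C⇒A⊎B A⇒C B⇒C disjoint
    with A? zero | B? zero | C? zero | count-disjoint-union (λ x → A? (suc x)) (λ x → B? (suc x)) (λ x → C? (suc x))
           (λ x → C⇒A⊎B (suc x)) (λ x → A⇒C (suc x)) (λ x → B⇒C (suc x)) (λ x → disjoint (suc x))
  ... | yes a | yes b | _     | _  = ⊥-elim (disjoint zero a b)
  ... | yes _ | no _  | yes _ | ih = cong suc ih
  ... | no _  | yes _ | yes _ | ih = trans (cong suc ih) (sym (+-suc _ _))
  ... | no _  | no _  | no _  | ih = ih
  ... | yes a | no _  | no ¬c | _  = ⊥-elim (¬c (A⇒C zero a))
  ... | no _  | yes b | no ¬c | _  = ⊥-elim (¬c (B⇒C zero b))
  ... | no ¬a | no ¬b | yes c | _  = ⊥-elim ([ ¬a , ¬b ]′ (C⇒A⊎B zero c))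

  count-none : ∀ {N} {A : Pred (Fin N) 0ℓ} (A? : Decidable A) → (∀ x → ¬ A x) → count A? ≡ 0
  count-none {zero}  A? none = refl
  count-none {suc N} A? none with A? zero
  ... | yes a = ⊥-elim (none zero a)
  ... | no _  = count-none (λ x → A? (suc x)) (λ x → none (suc x))

  count-single : ∀ {N} {A : Pred (Fin N) 0ℓ} (A? : Decidable A) (a : Fin N) →
                 A a → (∀ x → A x → x ≡ a) → count A? ≡ 1
  count-single {suc N} A? zero Aa only with A? zero
  ... | yes _  = cong suc (count-none (λ x → A? (suc x)) (λ x Ax → 0≢1+n (sym (only (suc x) Ax))))
  ... | no ¬Aa = ⊥-elim (¬Aa Aa)
  count-single {suc N} A? (suc a) Aa only with A? zero
  ... | yes A0 = ⊥-elim (0≢1+n (only zero A0))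
  ... | no _   = count-single (λ x → A? (suc x)) a Aa (λ x Ax → suc-injective (only (suc x) Ax))

module BreadthFirst where
  open import Data.Nat
  open import Data.Nat.Properties
  open import Data.Fin as Fin using (Fin; zero; suc; toℕ; fromℕ<)
  import Data.Fin.Properties as Finₚ
  open import Data.Product using (∃; _×_; _,_; proj₁; proj₂)
  open import Data.Sum using (_⊎_; inj₁; inj₂)
  open import Data.Empty using (⊥; ⊥-elim)
  open import Function using (_∘_; id)
  open import Relation.Binary.PropositionalEquality
  open import Relation.Binary.Definitions using (tri<; tri≈; tri>)
  open import Relation.Nullary using (¬_; Dec; yes; no)
  open import Relation.Nullary.Decidable using (¬?; _×-dec_; _⊎-dec_)
  open import Defs
  open SelfMaps using (injective⇒onto)
  open Counting
  open import Data.Nat.Solver using (module +-*-Solver)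
  open +-*-Solver using (solve; _:+_; _:*_; _:=_; con)
  open import Data.List using (allFin)
  open import Data.List.Extrema ≤-totalOrder using (argmax; f[xs]≤f[argmax])
  import Data.List.Relation.Unary.All as All
  open import Data.List.Membership.Propositional.Properties using (∈-allFin)

  odd-children-step : ∀ c i n a b → c + i ≡ suc (2 * a) → n ≡ suc (2 * b) → c + n + suc i ≡ suc (2 * suc (a + b))
  odd-children-step c i n a b c+i≡ n≡ = begin
    c + n + suc i                   ≡⟨ solve 3 (λ c i n → c :+ n :+ (con 1 :+ i) := con 1 :+ (c :+ i :+ n)) refl c i n ⟩
    suc (c + i + n)                 ≡⟨ cong₂ (λ x y → suc (x + y)) c+i≡ n≡ ⟩
    suc (suc (2 * a) + suc (2 * b)) ≡⟨ solve 2 (λ a b → con 1 :+ ((con 1 :+ con 2 :* a) :+ (con 1 :+ con 2 :* b))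
                                                       := con 1 :+ con 2 :* (con 1 :+ (a :+ b))) refl a b ⟩
    suc (2 * suc (a + b))           ∎
    where open ≡-Reasoning

  module Ranks (T : RTree) (isTree : IsTree T)
    (rk : Fin (size T) → Fin (size T)) (lex : IsLexOrder T rk) where

    N : ℕ
    N = size T

    depth : Fin N → ℕ
    depth x = proj₁ (isTree x)

    depth-unique : ∀ {x d d'} → AtDepth T x d → AtDepth T x d' → d ≡ d'
    depth-unique at-root          at-root          = refl
    depth-unique at-root          (at-step x≢r _) = ⊥-elim (x≢r refl)
    depth-unique (at-step x≢r _) at-root          = ⊥-elim (x≢r refl)
    depth-unique (at-step _ d)   (at-step _ d')   = cong suc (depth-unique d d')

    depth-child : ∀ {c u} → IsChild T c u → depth c ≡ suc (depth u)
    depth-child {c} {u} (c≢r , parent≡u) =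
      depth-unique (proj₂ (isTree c)) (at-step c≢r (subst (λ v → AtDepth T v (depth u)) (sym parent≡u) (proj₂ (isTree u))))

    rank : Fin N → ℕ
    rank x = toℕ (rk x)

    rank<N : ∀ x → rank x < N
    rank<N x = Finₚ.toℕ<n (rk x)

    rank-injective : ∀ {x y} → rank x ≡ rank y → x ≡ y
    rank-injective eq = proj₁ lex (Finₚ.toℕ-injective eq)

    vertexAt : ∀ {j} → j < N → Fin N
    vertexAt j<N = proj₁ (injective⇒onto rk (proj₁ lex) (fromℕ< j<N))

    rank-vertexAt : ∀ {j} (j<N : j < N) → rank (vertexAt j<N) ≡ j
    rank-vertexAt j<N = trans (cong toℕ (proj₂ (injective⇒onto rk (proj₁ lex) (fromℕ< j<N)))) (Finₚ.toℕ-fromℕ< j<N)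

    depth-monotone : ∀ u w → rank u < rank w → depth u ≤ depth w
    depth-monotone u w = proj₁ (proj₂ lex) u w _ _ (proj₂ (isTree u)) (proj₂ (isTree w))

    children-ordered : ∀ {u w c e} → rank u < rank w → IsChild T c u → IsChild T e w → rank c < rank e
    children-ordered = proj₂ (proj₂ lex) _ _ _ _

    -- A child is deeper than its parent, hence comes after it.
    parent-before-child : ∀ {c u} → IsChild T c u → rank u < rank c
    parent-before-child {c} {u} c-u with <-cmp (rank u) (rank c)
    ... | tri< u<c _ _ = u<c
    ... | tri≈ _ u≡c _ = ⊥-elim (1+n≰n (subst (_≤ depth u) (depth-child c-u) (≤-reflexive (cong depth (rank-injective (sym u≡c))))))
    ... | tri> _ _ c<u = ⊥-elim (1+n≰n (subst (_≤ depth u) (depth-child c-u) (depth-monotone c u c<u)))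

    0<N : 0 < N
    0<N = ≤-<-trans z≤n (rank<N (root T))

    -- The root comes first: otherwise its parent would precede rank 0.
    rank-root : rank (root T) ≡ 0
    rank-root with vertexAt 0<N Fin.≟ root T
    ... | yes first≡r = trans (cong rank (sym first≡r)) (rank-vertexAt 0<N)
    ... | no first≢r  = ⊥-elim (n≮0 (subst (rank (parent T (vertexAt 0<N)) <_) (rank-vertexAt 0<N)
                                            (parent-before-child (first≢r , refl))))

    nonroot : ∀ {x} → 1 ≤ rank x → x ≢ root T
    nonroot {x} 1≤rank x≡r = 1+n≰n (subst (1 ≤_) rank-root (subst (λ y → 1 ≤ rank y) x≡r 1≤rank))

    parent-monotone : ∀ x x' → x ≢ root T → x' ≢ root T → rank x ≤ rank x' →
                      rank (parent T x) ≤ rank (parent T x')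
    parent-monotone x x' x≢r x'≢r x≤x' with rank (parent T x') <? rank (parent T x)
    ... | yes later = ⊥-elim (<⇒≱ (children-ordered later (x'≢r , refl) (x≢r , refl)) x≤x')
    ... | no ¬later = ≮⇒≥ ¬later

  module OddRadial (T : RTree) (isTree : IsTree T) (oddRadial : IsOddRadial T)
    (rk : Fin (size T) → Fin (size T)) (lex : IsLexOrder T rk)
    (m : ℕ) (vs : Fin (suc m) → Fin (size T)) (listing : IsLeafListing T rk vs) where

    open Ranks T isTree rk lex public

    isLeaf? : ∀ x → Dec (IsLeaf T x)
    isLeaf? x = Finₚ.all? (λ c → ¬? (isChild? T c x))

    child-of-internal : ∀ x → ¬ IsLeaf T x → ∃ λ c → IsChild T c x
    child-of-internal x ¬leaf with Finₚ.any? (λ c → isChild? T c x)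
    ... | yes child = child
    ... | no ¬child = ⊥-elim (¬leaf (λ c c-x → ¬child (c , c-x)))

    deepest : Fin N
    deepest = argmax depth (root T) (allFin N)

    deepest-max : ∀ x → depth x ≤ depth deepest
    deepest-max x = All.lookup (f[xs]≤f[argmax] {f = depth} (root T) (allFin N)) (∈-allFin x)

    -- Since the tree is radial, all leaves lie at the maximal depth, so
    -- every vertex with a child comes before every leaf.
    leaf-depth : ∀ {x} → IsLeaf T x → depth x ≡ depth deepest
    leaf-depth {x} x-leaf = proj₁ oddRadial x deepest _ _ x-leaf deepest-leaf (proj₂ (isTree x)) (proj₂ (isTree deepest))
      where
      deepest-leaf : IsLeaf T deepest
      deepest-leaf c c-deepest = 1+n≰n (subst (_≤ depth deepest) (depth-child c-deepest) (deepest-max c))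

    internal-before-leaf : ∀ {c u x} → IsChild T c u → IsLeaf T x → rank u < rank x
    internal-before-leaf {c} {u} {x} c-u x-leaf with <-cmp (rank u) (rank x)
    ... | tri< u<x _ _ = u<x
    ... | tri≈ _ u≡x _ = ⊥-elim (subst (IsLeaf T) (sym (rank-injective u≡x)) x-leaf c c-u)
    ... | tri> _ _ x<u = ⊥-elim (<⇒≱ (subst (_≤ depth deepest) (depth-child c-u) (deepest-max c))
                                     (subst (_≤ depth u) (leaf-depth x-leaf) (depth-monotone x u x<u)))

    -- p is the rank of the first leaf; the ranks p, ..., N - 1 are exactly the leaves.
    p : ℕ
    p = rank (vs zero)

    p<N : p < N
    p<N = rank<N (vs zero)

    leaf⇒p≤rank : ∀ {x} → IsLeaf T x → p ≤ rank x
    leaf⇒p≤rank {x} x-leaf with proj₁ (proj₂ listing) x x-leaf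
    ... | zero  , vs0≡x = ≤-reflexive (cong rank vs0≡x)
    ... | suc i , vsi≡x = <⇒≤ (subst (λ y → p < rank y) vsi≡x (proj₂ (proj₂ listing) zero (suc i) (s≤s z≤n)))

    parent<p : ∀ {c u} → IsChild T c u → rank u < p
    parent<p c-u = internal-before-leaf c-u (proj₁ listing zero)

    p≤rank⇒leaf : ∀ y → p ≤ rank y → IsLeaf T y
    p≤rank⇒leaf y p≤y with isLeaf? y
    ... | yes y-leaf = y-leaf
    ... | no ¬leaf   = ⊥-elim (<⇒≱ (parent<p (proj₂ (child-of-internal y ¬leaf))) p≤y)

    child-before-p : ∀ {j} (j<p : j < p) → ∃ λ c → IsChild T c (vertexAt (<-trans j<p p<N))
    child-before-p {j} j<p = child-of-internal (vertexAt j<N) λ leaf → <⇒≱ j<p (subst (p ≤_) (rank-vertexAt j<N) (leaf⇒p≤rank leaf))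
      where
      j<N : j < N
      j<N = <-trans j<p p<N

    data PositionView (j : ℕ) : Set where
      old : ∀ x → rank x ≡ j → PositionView j
      new : N ≤ j → PositionView j

    positionView : ∀ j → PositionView j
    positionView j with j <? N
    ... | yes j<N = old (vertexAt j<N) (rank-vertexAt j<N)
    ... | no j≮N  = new (≮⇒≥ j≮N)

    -- The position of the parent of the vertex at position j ≥ 1; positions
    -- beyond N will hold the leaves attached to the first leaf, at position p.
    parentPos : ℕ → ℕ
    parentPos j with j <? N
    ... | yes j<N = rank (parent T (vertexAt j<N))
    ... | no _    = p

    parentPos-rank : ∀ x → parentPos (rank x) ≡ rank (parent T x)
    parentPos-rank x with rank x <? N
    ... | yes x<N = cong (rank ∘ parent T) (rank-injective (rank-vertexAt x<N))
    ... | no x≮N  = ⊥-elim (x≮N (rank<N x))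

    parentPos-beyond : ∀ {j} → N ≤ j → parentPos j ≡ p
    parentPos-beyond {j} N≤j with j <? N
    ... | yes j<N = ⊥-elim (<⇒≱ j<N N≤j)
    ... | no _    = refl

    parentPos-below : ∀ j → 1 ≤ j → parentPos j < j
    parentPos-below j 1≤j with positionView j
    ... | old x refl = subst (_< rank x) (sym (parentPos-rank x)) (parent-before-child (nonroot 1≤j , refl))
    ... | new N≤j    = subst (_< j) (sym (parentPos-beyond N≤j)) (<-≤-trans p<N N≤j)

    parentPos-monotone : ∀ j j' → 1 ≤ j → j ≤ j' → parentPos j ≤ parentPos j'
    parentPos-monotone j j' 1≤j j≤j' with positionView j | positionView j'
    ... | old x refl | old x' refl = subst₂ _≤_ (sym (parentPos-rank x)) (sym (parentPos-rank x'))
          (parent-monotone x x' (nonroot 1≤j) (nonroot (≤-trans 1≤j j≤j')) j≤j')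
    ... | old x refl | new N≤j'    = subst₂ _≤_ (sym (parentPos-rank x)) (sym (parentPos-beyond N≤j'))
          (<⇒≤ (parent<p (nonroot 1≤j , refl)))
    ... | new N≤j    | old x' refl = ⊥-elim (<⇒≱ (rank<N x') (≤-trans N≤j j≤j'))
    ... | new N≤j    | new N≤j'    = ≤-reflexive (trans (parentPos-beyond N≤j) (sym (parentPos-beyond N≤j')))

    next-parent-child : ∀ x → x ≢ root T → (next<p : suc (rank (parent T x)) < p) →
                        ∃ λ c → IsChild T c (vertexAt (<-trans next<p p<N)) × rank x < rank c
    next-parent-child x x≢r next<p with child-before-p next<p
    ... | c , c-z = c , c-z , children-ordered parent<z (x≢r , refl) c-z
      where
      parent<z : rank (parent T x) < rank (vertexAt (<-trans next<p p<N))
      parent<z = subst (rank (parent T x) <_) (sym (rank-vertexAt (<-trans next<p p<N))) (n<1+n _)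

    -- Consecutive vertices x, y have parents at most one position apart:
    -- otherwise the vertex right after the parent of x would have a child
    -- strictly between x and y.
    parent-no-skip : ∀ x y → x ≢ root T → rank y ≡ suc (rank x) →
                     rank (parent T y) ≤ suc (rank (parent T x))
    parent-no-skip x y x≢r rank-y with rank (parent T y) ≤? suc (rank (parent T x))
    ... | yes close = close
    ... | no far = ⊥-elim (<⇒≱ (subst (rank c <_) rank-y c<y) x<c)
      where
      y≢r : y ≢ root T
      y≢r = nonroot (subst (1 ≤_) (sym rank-y) (s≤s z≤n))
      next<y : suc (rank (parent T x)) < rank (parent T y)
      next<y = ≰⇒> far
      next<p : suc (rank (parent T x)) < p
      next<p = <-≤-trans next<y (<⇒≤ (parent<p (y≢r , refl)))
      c : Fin N
      c = proj₁ (next-parent-child x x≢r next<p)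
      c-z : IsChild T c (vertexAt (<-trans next<p p<N))
      c-z = proj₁ (proj₂ (next-parent-child x x≢r next<p))
      x<c : rank x < rank c
      x<c = proj₂ (proj₂ (next-parent-child x x≢r next<p))
      c<y : rank c < rank y
      c<y = children-ordered (subst (_< rank (parent T y)) (sym (rank-vertexAt (<-trans next<p p<N))) next<y) c-z (y≢r , refl)

    -- Likewise the parent of the last vertex x is immediately followed by the
    -- leaves: a vertex before p right after it would have a child after x.
    last-parent : ∀ x → x ≢ root T → N ≤ suc (rank x) → p ≤ suc (rank (parent T x))
    last-parent x x≢r N≤x+1 with suc (rank (parent T x)) <? p
    ... | no next≮p  = ≮⇒≥ next≮p
    ... | yes next<p with next-parent-child x x≢r next<p
    ...   | c , _ , x<c = ⊥-elim (<⇒≱ (rank<N c) (≤-trans N≤x+1 x<c))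

    parentPos-slow : ∀ j → 1 ≤ j → parentPos (suc j) ≤ suc (parentPos j)
    parentPos-slow j 1≤j with positionView j | positionView (suc j)
    ... | old x refl | old y rank-y = subst₂ (λ a b → a ≤ suc b)
          (sym (trans (cong parentPos (sym rank-y)) (parentPos-rank y))) (sym (parentPos-rank x))
          (parent-no-skip x y (nonroot 1≤j) rank-y)
    ... | old x refl | new N≤x+1 = subst₂ (λ a b → a ≤ suc b) (sym (parentPos-beyond N≤x+1)) (sym (parentPos-rank x))
          (last-parent x (nonroot 1≤j) N≤x+1)
    ... | new N≤j | old y rank-y = ⊥-elim (<⇒≱ (rank<N y) (subst (N ≤_) (sym rank-y) (m≤n⇒m≤1+n N≤j)))
    ... | new N≤j | new N≤j+1    = subst₂ (λ a b → a ≤ suc b) (sym (parentPos-beyond N≤j+1)) (sym (parentPos-beyond N≤j)) (n≤1+n p)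

    -- Counting argument for the parity condition.  Settled i consists of
    -- the root and the vertices whose parent comes before position i.
    Settled : ℕ → Fin N → Set
    Settled i y = (y ≡ root T) ⊎ (y ≢ root T × rank (parent T y) < i)

    settled? : ∀ i y → Dec (Settled i y)
    settled? i y = (y Fin.≟ root T) ⊎-dec (¬? (y Fin.≟ root T) ×-dec (rank (parent T y) <? i))

    settled-0 : count (settled? 0) ≡ 1
    settled-0 = count-single (settled? 0) (root T) (inj₁ refl) only-root
      where
      only-root : ∀ y → Settled 0 y → y ≡ root T
      only-root y (inj₁ y≡r) = y≡r

    settled-suc : ∀ i x → rank x ≡ i → count (settled? (suc i)) ≡ count (settled? i) + numChildren T x
    settled-suc i x rank-x = trans
      (count-disjoint-union (settled? i) (λ c → isChild? T c x) (settled? (suc i)) split earlier later-child disjoint)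
      (cong (count (settled? i) +_) (sym (length-filter-tabulate (λ c → isChild? T c x) id)))
      where
      split : ∀ y → Settled (suc i) y → Settled i y ⊎ IsChild T y x
      split y (inj₁ y≡r) = inj₁ (inj₁ y≡r)
      split y (inj₂ (y≢r , parent<i+1)) with m≤n⇒m<n∨m≡n (≤-pred parent<i+1)
      ... | inj₁ parent<i = inj₁ (inj₂ (y≢r , parent<i))
      ... | inj₂ parent≡i = inj₂ (y≢r , rank-injective (trans parent≡i (sym rank-x)))
      earlier : ∀ y → Settled i y → Settled (suc i) y
      earlier y (inj₁ y≡r) = inj₁ y≡r
      earlier y (inj₂ (y≢r , parent<i)) = inj₂ (y≢r , m<n⇒m<1+n parent<i)
      later-child : ∀ y → IsChild T y x → Settled (suc i) y
      later-child y (y≢r , parent≡x) = inj₂ (y≢r , s≤s (≤-reflexive (trans (cong rank parent≡x) rank-x)))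
      disjoint : ∀ y → Settled i y → ¬ IsChild T y x
      disjoint y (inj₁ y≡r) (y≢r , _) = y≢r y≡r
      disjoint y (inj₂ (_ , parent<i)) (_ , parent≡x) = <-irrefl (trans (cong rank parent≡x) rank-x) parent<i

    -- Every vertex before p has an odd number of children, so the count of
    -- Settled i changes parity together with i.
    settled-parity : ∀ i → i ≤ p → Odd (count (settled? i) + i)
    settled-parity zero _ = 0 , cong (_+ 0) settled-0
    settled-parity (suc i) i+1≤p with settled-parity i (≤-trans (n≤1+n i) i+1≤p)
    ... | a , odd-count = suc (a + b) , (begin
      count (settled? (suc i)) + suc i          ≡⟨ cong (_+ suc i) (settled-suc i x (rank-vertexAt i<N)) ⟩
      count (settled? i) + numChildren T x + suc i ≡⟨ odd-children-step (count (settled? i)) i (numChildren T x) a b odd-count odd-children ⟩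
      suc (2 * suc (a + b))                        ∎)
      where
      open ≡-Reasoning
      i<N : i < N
      i<N = <-≤-trans i+1≤p (<⇒≤ p<N)
      x : Fin N
      x = vertexAt i<N
      internal : ¬ IsLeaf T x
      internal x-leaf = <⇒≱ i+1≤p (subst (p ≤_) (rank-vertexAt i<N) (leaf⇒p≤rank x-leaf))
      b : ℕ
      b = proj₁ (proj₂ oddRadial x internal)
      odd-children : numChildren T x ≡ suc (2 * b)
      odd-children = proj₂ (proj₂ oddRadial x internal)

    count-before : ∀ j → j ≤ N → count (λ y → rank y <? j) ≡ j
    count-before zero _ = count-none (λ y → rank y <? 0) (λ y ())
    count-before (suc j) j+1≤N = begin
      count (λ y → rank y <? suc j)                      ≡⟨ count-disjoint-union (λ y → rank y <? j) (λ y → rank y ≟ j)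
                                                              (λ y → rank y <? suc j) split earlier at-j disjoint ⟩
      count (λ y → rank y <? j) + count (λ y → rank y ≟ j) ≡⟨ cong₂ _+_ (count-before j (≤-trans (n≤1+n j) j+1≤N))
                                                              (count-single (λ y → rank y ≟ j) (vertexAt j+1≤N) (rank-vertexAt j+1≤N)
                                                                 (λ y rank-y → rank-injective (trans rank-y (sym (rank-vertexAt j+1≤N))))) ⟩
      j + 1                                              ≡⟨ +-comm j 1 ⟩
      suc j                                              ∎
      where
      open ≡-Reasoning
      split : ∀ y → rank y < suc j → rank y < j ⊎ rank y ≡ j
      split y y<j+1 = m≤n⇒m<n∨m≡n (≤-pred y<j+1)
      earlier : ∀ y → rank y < j → rank y < suc j
      earlier y = m<n⇒m<1+n
      at-j : ∀ y → rank y ≡ j → rank y < suc j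
      at-j y rank-y = s≤s (≤-reflexive rank-y)
      disjoint : ∀ y → rank y < j → rank y ≢ j
      disjoint y y<j rank-y = <-irrefl rank-y y<j

    -- All parents come before p, so Settled p is the whole tree.
    settled-all : count (settled? p) ≡ N
    settled-all = trans (count-cong (settled? p) (λ y → rank y <? N) (λ y _ → rank<N y) all-settled) (count-before N ≤-refl)
      where
      all-settled : ∀ y → rank y < N → Settled p y
      all-settled y _ with y Fin.≟ root T
      ... | yes y≡r = inj₁ y≡r
      ... | no y≢r  = inj₂ (y≢r , parent<p (y≢r , refl))

    N+p-odd : Odd (N + p)
    N+p-odd = subst (λ c → Odd (c + p)) settled-all (settled-parity p ≤-refl)

    settled-at-jump : ∀ x y → 1 ≤ rank x → rank y ≡ suc (rank x) →
                      rank (parent T x) < rank (parent T y) →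
                      count (settled? (rank (parent T y))) ≡ suc (rank x)
    settled-at-jump x y 1≤x rank-y jump =
      trans (count-cong (settled? (rank (parent T y))) (λ w → rank w <? suc (rank x)) before-y settled)
            (count-before (suc (rank x)) (subst (_≤ N) rank-y (<⇒≤ (rank<N y))))
      where
      y≢r : y ≢ root T
      y≢r = nonroot (subst (1 ≤_) (sym rank-y) (s≤s z≤n))
      before-y : ∀ w → Settled (rank (parent T y)) w → rank w < suc (rank x)
      before-y w (inj₁ refl) = subst (_< suc (rank x)) (sym rank-root) (s≤s z≤n)
      before-y w (inj₂ (w≢r , parent-w<)) with rank w <? suc (rank x)
      ... | yes w<y = w<y
      ... | no w≮y  = ⊥-elim (<⇒≱ parent-w< (parent-monotone y w y≢r w≢r (subst (_≤ rank w) (sym rank-y) (≮⇒≥ w≮y))))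
      settled : ∀ w → rank w < suc (rank x) → Settled (rank (parent T y)) w
      settled w w≤x with w Fin.≟ root T
      ... | yes w≡r = inj₁ w≡r
      ... | no w≢r  = inj₂ (w≢r , ≤-<-trans (parent-monotone w x w≢r (nonroot 1≤x) (≤-pred w≤x)) jump)

    parentPos-jumpParity : ∀ j → 1 ≤ j → parentPos j < parentPos (suc j) → Odd (suc j + parentPos (suc j))
    parentPos-jumpParity j 1≤j jump with positionView j | positionView (suc j)
    ... | old x refl | old y rank-y = subst (λ q → Odd (suc (rank x) + q)) (sym parentPos-y)
          (subst (λ c → Odd (c + rank (parent T y))) (settled-at-jump x y 1≤j rank-y jump')
                 (settled-parity _ (<⇒≤ (parent<p (y≢r , refl)))))
      where
      parentPos-y : parentPos (suc (rank x)) ≡ rank (parent T y)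
      parentPos-y = trans (cong parentPos (sym rank-y)) (parentPos-rank y)
      y≢r : y ≢ root T
      y≢r = nonroot (subst (1 ≤_) (sym rank-y) (s≤s z≤n))
      jump' : rank (parent T x) < rank (parent T y)
      jump' = subst₂ _<_ (parentPos-rank x) parentPos-y jump
    ... | old x refl | new N≤x+1 = subst (λ q → Odd (suc (rank x) + q)) (sym (parentPos-beyond N≤x+1))
          (subst (λ c → Odd (c + p)) (≤-antisym N≤x+1 (rank<N x)) N+p-odd)
    ... | new N≤j | old y rank-y = ⊥-elim (<⇒≱ (rank<N y) (subst (N ≤_) (sym rank-y) (m≤n⇒m≤1+n N≤j)))
    ... | new N≤j | new N≤j+1    = ⊥-elim (<-irrefl (trans (parentPos-beyond N≤j) (sym (parentPos-beyond N≤j+1))) jump)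

    listed-order : ∀ i j → toℕ i < toℕ j → rank (vs i) < rank (vs j)
    listed-order = proj₂ (proj₂ listing)

    listed-order⁻¹ : ∀ i j → rank (vs i) < rank (vs j) → toℕ i < toℕ j
    listed-order⁻¹ i j vi<vj with <-cmp (toℕ i) (toℕ j)
    ... | tri< i<j _ _ = i<j
    ... | tri≈ _ i≡j _ = ⊥-elim (<-irrefl (cong (rank ∘ vs) (Finₚ.toℕ-injective i≡j)) vi<vj)
    ... | tri> _ _ j<i = ⊥-elim (<-asym vi<vj (listed-order j i j<i))

    listed-at : ∀ q → p ≤ q → (q<N : q < N) → ∃ λ a → rank (vs a) ≡ q
    listed-at q p≤q q<N with proj₁ (proj₂ listing) (vertexAt q<N) (p≤rank⇒leaf _ (subst (p ≤_) (sym (rank-vertexAt q<N)) p≤q))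
    ... | a , vs-a≡ = a , trans (cong rank vs-a≡) (rank-vertexAt q<N)

    -- By induction on t: a leaf strictly between the positions of the t-th and
    -- the (t + 1)-th listed leaves would be listed strictly between them.
    rank-listed-ℕ : ∀ t (t≤m : t < suc m) → rank (vs (fromℕ< t≤m)) ≡ p + t
    rank-listed-ℕ zero    _   = sym (+-identityʳ p)
    rank-listed-ℕ (suc t) t+1≤m with rank (vs (fromℕ< t+1≤m)) ≤? p + suc t
    ... | yes at-most = ≤-antisym at-most (subst (_≤ rank (vs (fromℕ< t+1≤m))) (sym (+-suc p t))
                                            (subst (_< rank (vs (fromℕ< t+1≤m))) (rank-listed-ℕ t t≤m) after))
      where
      t≤m : t < suc m
      t≤m = <-trans (n<1+n t) t+1≤m
      after : rank (vs (fromℕ< t≤m)) < rank (vs (fromℕ< t+1≤m))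
      after = listed-order _ _ (subst₂ _<_ (sym (Finₚ.toℕ-fromℕ< t≤m)) (sym (Finₚ.toℕ-fromℕ< t+1≤m)) (n<1+n t))
    ... | no beyond = ⊥-elim (<⇒≱ (subst (toℕ a <_) (Finₚ.toℕ-fromℕ< t+1≤m) (listed-order⁻¹ a (fromℕ< t+1≤m) a<t+1'))
                                  (subst (_< toℕ a) (Finₚ.toℕ-fromℕ< t≤m) (listed-order⁻¹ (fromℕ< t≤m) a t<a)))
      where
      t≤m : t < suc m
      t≤m = <-trans (n<1+n t) t+1≤m
      q<N : p + suc t < N
      q<N = <-trans (≰⇒> beyond) (rank<N _)
      a : Fin (suc m)
      a = proj₁ (listed-at (p + suc t) (m≤m+n p _) q<N)
      rank-a : rank (vs a) ≡ p + suc t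
      rank-a = proj₂ (listed-at (p + suc t) (m≤m+n p _) q<N)
      a<t+1' : rank (vs a) < rank (vs (fromℕ< t+1≤m))
      a<t+1' = subst (_< rank (vs (fromℕ< t+1≤m))) (sym rank-a) (≰⇒> beyond)
      t<a : rank (vs (fromℕ< t≤m)) < rank (vs a)
      t<a = subst₂ _<_ (sym (rank-listed-ℕ t t≤m)) (sym rank-a) (+-monoʳ-< p (n<1+n t))

    rank-listed : ∀ i → rank (vs i) ≡ p + toℕ i
    rank-listed i = trans (cong (rank ∘ vs) (sym (Finₚ.fromℕ<-toℕ i (Finₚ.toℕ<n i)))) (rank-listed-ℕ (toℕ i) (Finₚ.toℕ<n i))

module Attached (T : RTree) (isTree : IsTree T) (oddRadial : IsOddRadial T)
  (rk : Fin (size T) → Fin (size T)) (lex : IsLexOrder T rk)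
  (m : ℕ) (vs : Fin (suc m) → Fin (size T)) (listing : IsLeafListing T rk vs) (k : ℕ) where
  open import Data.Nat
  open import Data.Nat.Properties
  open import Data.Fin as Fin using (Fin; zero; suc; toℕ; fromℕ<; _↑ˡ_; _↑ʳ_; splitAt)
  import Data.Fin.Properties as Finₚ
  open import Data.Integer as ℤ using (ℤ)
  open import Data.Product using (∃; ∃₂; _×_; _,_; proj₁; proj₂)
  open import Data.Sum using (_⊎_; inj₁; inj₂; [_,_]′)
  open import Data.Empty using (⊥-elim)
  open import Function.Definitions using (Injective)
  open import Relation.Binary.PropositionalEquality
  open import Relation.Nullary using (Dec; yes; no)
  open import Defs
  open Zigzag
  open EdgeLabels
  open BreadthFirst

  open OddRadial T isTree oddRadial rk lex m vs listing

  T' : RTree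
  T' = attach T (vs zero) k

  n : ℕ
  n = N + k ∸ 1

  N+k≡1+n : N + k ≡ suc n
  N+k≡1+n = sym (suc-pred (N + k) {{>-nonZero (≤-trans 0<N (m≤m+n N k))}})

  data VertexView : Fin (N + k) → Set where
    old : ∀ y → VertexView (y ↑ˡ k)
    new : ∀ t → VertexView (N ↑ʳ t)

  vertexView : ∀ x → VertexView x
  vertexView x with splitAt N x in split≡
  ... | inj₁ y = subst VertexView (Finₚ.splitAt⁻¹-↑ˡ split≡) (old y)
  ... | inj₂ t = subst VertexView (Finₚ.splitAt⁻¹-↑ʳ split≡) (new t)

  old≢new : ∀ y t → y ↑ˡ k ≢ N ↑ʳ t
  old≢new y t eq = <⇒≱ (Finₚ.toℕ<n y)
    (subst (N ≤_) (trans (sym (Finₚ.toℕ-↑ʳ N t)) (trans (cong toℕ (sym eq)) (Finₚ.toℕ-↑ˡ y k))) (m≤m+n N (toℕ t)))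

  parent-old : ∀ y → parent T' (y ↑ˡ k) ≡ parent T y ↑ˡ k
  parent-old y rewrite Finₚ.splitAt-↑ˡ N y k = refl

  parent-new : ∀ t → parent T' (N ↑ʳ t) ≡ vs zero ↑ˡ k
  parent-new t rewrite Finₚ.splitAt-↑ʳ N k t = refl

  pos : Fin (N + k) → ℕ
  pos x = [ rank , (λ t → N + toℕ t) ]′ (splitAt N x)

  pos-old : ∀ y → pos (y ↑ˡ k) ≡ rank y
  pos-old y rewrite Finₚ.splitAt-↑ˡ N y k = refl

  pos-new : ∀ t → pos (N ↑ʳ t) ≡ N + toℕ t
  pos-new t rewrite Finₚ.splitAt-↑ʳ N k t = refl

  pos≤n : ∀ x → pos x ≤ n
  pos≤n x with vertexView x
  ... | old y = subst (_≤ n) (sym (pos-old y)) (<⇒≤pred (<-≤-trans (rank<N y) (m≤m+n N k)))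
  ... | new t = subst (_≤ n) (sym (pos-new t)) (<⇒≤pred (+-monoʳ-< N (Finₚ.toℕ<n t)))

  pos-injective : ∀ {x x'} → pos x ≡ pos x' → x ≡ x'
  pos-injective {x} {x'} eq with vertexView x | vertexView x'
  ... | old y | old y' = cong (_↑ˡ k) (rank-injective (trans (sym (pos-old y)) (trans eq (pos-old y'))))
  ... | new t | new t' = cong (N ↑ʳ_) (Finₚ.toℕ-injective (+-cancelˡ-≡ N _ _ (trans (sym (pos-new t)) (trans eq (pos-new t')))))
  ... | old y | new t' = ⊥-elim (<⇒≱ (rank<N y) (subst (N ≤_) (trans (sym (pos-new t')) (trans (sym eq) (pos-old y))) (m≤m+n N _)))
  ... | new t | old y' = ⊥-elim (<⇒≱ (rank<N y') (subst (N ≤_) (trans (sym (pos-new t)) (trans eq (pos-old y'))) (m≤m+n N _)))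

  new-at : ∀ q → N ≤ q → q ≤ n → ∃ λ t → pos (N ↑ʳ t) ≡ q
  new-at q N≤q q≤n = fromℕ< q-N<k , trans (pos-new _) (trans (cong (N +_) (Finₚ.toℕ-fromℕ< q-N<k)) (m+[n∸m]≡n N≤q))
    where
    q-N<k : q ∸ N < k
    q-N<k = +-cancelˡ-< N (q ∸ N) k (subst₂ _<_ (sym (m+[n∸m]≡n N≤q)) (sym N+k≡1+n) (s≤s q≤n))

  at-position : ∀ j → j ≤ n → ∃ λ x → pos x ≡ j
  at-position j j≤n with positionView j
  ... | old y rank-y = y ↑ˡ k , trans (pos-old y) rank-y
  ... | new N≤j      = N ↑ʳ proj₁ (new-at j N≤j j≤n) , proj₂ (new-at j N≤j j≤n)

  edge : ∀ x → x ≢ root T' → 1 ≤ pos x × pos (parent T' x) ≡ parentPos (pos x)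
  edge x x≢r with vertexView x
  ... | old y = subst (1 ≤_) (sym (pos-old y)) 1≤rank ,
    trans (cong pos (parent-old y)) (trans (pos-old (parent T y)) (sym (trans (cong parentPos (pos-old y)) (parentPos-rank y))))
    where
    1≤rank : 1 ≤ rank y
    1≤rank with rank y in rank-y
    ... | zero  = ⊥-elim (x≢r (cong (_↑ˡ k) (rank-injective (trans rank-y (sym rank-root)))))
    ... | suc _ = s≤s z≤n
  ... | new t = subst (1 ≤_) (sym (pos-new t)) (≤-trans 0<N (m≤m+n N _)) ,
    trans (cong pos (parent-new t)) (trans (pos-old (vs zero)) (sym (trans (cong parentPos (pos-new t)) (parentPos-beyond (m≤m+n N _)))))

  open ParentMap n parentPos
    (λ j 1≤j _ → parentPos-below j 1≤j) (λ j j' 1≤j j≤j' _ → parentPos-monotone j j' 1≤j j≤j')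
    (λ j 1≤j _ → parentPos-slow j 1≤j) (λ j 1≤j _ → parentPos-jumpParity j 1≤j)

  f : Fin (N + k) → ℕ
  f x = zigzag n (pos x)

  edge-label : ∀ x → x ≢ root T' → ∣ f x - f (parent T' x) ∣ ≡ edgeLabel (pos x)
  edge-label x x≢r = cong (λ q → ∣ f x - zigzag n q ∣) (proj₂ (edge x x≢r))

  graceful : IsGraceful T' f
  graceful = f-injective , (λ x → zigzag-≤ (pos≤n x)) , label-range , label-onto
    where
    f-injective : Injective _≡_ _≡_ f
    f-injective eq = pos-injective (zigzag-injective (pos≤n _) (pos≤n _) eq)
    label-range : ∀ x → x ≢ root T' → 1 ≤ ∣ f x - f (parent T' x) ∣ × ∣ f x - f (parent T' x) ∣ ≤ n
    label-range x x≢r = subst (λ l → 1 ≤ l × l ≤ n) (sym (edge-label x x≢r))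
                          (edgeLabel-range (pos x) (proj₁ (edge x x≢r)) (pos≤n x))
    label-onto : ∀ l → 1 ≤ l → l ≤ n → ∃ λ x → x ≢ root T' × ∣ f x - f (parent T' x) ∣ ≡ l
    label-onto l 1≤l l≤n with edgeLabel-onto l 1≤l l≤n
    ... | j , 1≤j , j≤n , label-j with at-position j j≤n
    ...   | x , pos-x = x , x≢r , trans (edge-label x x≢r) (trans (cong edgeLabel pos-x) label-j)
      where
      x≢r : x ≢ root T'
      x≢r x≡r = 1+n≰n (subst (1 ≤_) (trans (sym pos-x) (trans (cong pos x≡r) (trans (pos-old (root T)) rank-root))) 1≤j)

  f-root : f (root T ↑ˡ k) ≡ 0
  f-root = cong (zigzag n) (trans (pos-old (root T)) rank-root)

  pos-listed : ∀ i → pos (vs i ↑ˡ k) ≡ p + toℕ i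
  pos-listed i = trans (pos-old (vs i)) (rank-listed i)

  listed-injective : Injective _≡_ _≡_ (λ i → vs i ↑ˡ k)
  listed-injective {i} {j} eq =
    Finₚ.toℕ-injective (+-cancelˡ-≡ p _ _ (trans (sym (pos-listed i)) (trans (cong pos eq) (pos-listed j))))

  listed-labels : ∀ {s a b} → (∀ i → p + i ≤ n → ℤ.+ zigzag n (p + i) ≡ alt a b s i) →
                  ∀ i → ℤ.+ f (vs i ↑ˡ k) ≡ alt a b s (toℕ i)
  listed-labels alt-from i = trans (cong (λ q → ℤ.+ zigzag n q) (pos-listed i))
                                   (alt-from (toℕ i) (subst (_≤ n) (pos-listed i) (pos≤n _)))

  listed-alternate : ∀ {a b} → AlternatingFrom n p a b → IsAlternating f (λ i → vs i ↑ˡ k) a b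
  listed-alternate (inj₁ up)   = listed-injective , inj₁ (listed-labels up)
  listed-alternate (inj₂ down) = listed-injective , inj₂ (listed-labels down)

  new-leaf : ∀ t → IsLeaf T' (N ↑ʳ t) × IsChild T' (N ↑ʳ t) (vs zero ↑ˡ k)
  new-leaf t = no-children , (λ new≡r → old≢new (root T) t (sym new≡r)) , parent-new t
    where
    no-children : IsLeaf T' (N ↑ʳ t)
    no-children c (_ , parent-c) with vertexView c
    ... | old y  = old≢new (parent T y) t (trans (sym (parent-old y)) parent-c)
    ... | new t' = old≢new (vs zero) t (trans (sym (parent-new t')) parent-c)

  LabelWindow : ℤ → ℤ → Set
  LabelWindow c d = (∀ t → c ℤ.≤ ℤ.+ f (N ↑ʳ t) × ℤ.+ f (N ↑ʳ t) ℤ.≤ d)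
                  × (∀ l → c ℤ.≤ l → l ℤ.≤ d → ∃ λ t → ℤ.+ f (N ↑ʳ t) ≡ l)

  -- They occupy the tail N, ..., n of positions, whose labels form the
  -- window [⌈ N/2 ⌉, n ∸ ⌊ N/2 ⌋].
  attached-window : N ≤ n → LabelWindow (ℤ.+ ⌈ N /2⌉) (ℤ.+ (n ∸ ⌊ N /2⌋))
  attached-window N≤n = in-window , onto
    where
    in-window : ∀ t → ℤ.+ ⌈ N /2⌉ ℤ.≤ ℤ.+ f (N ↑ʳ t) × ℤ.+ f (N ↑ʳ t) ℤ.≤ ℤ.+ (n ∸ ⌊ N /2⌋)
    in-window t with zigzag-tail-range {n} {N} {pos (N ↑ʳ t)} (subst (N ≤_) (sym (pos-new t)) (m≤m+n N _)) (pos≤n _)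
    ... | lo , hi = ℤ.+≤+ lo , ℤ.+≤+ hi
    onto : ∀ l → ℤ.+ ⌈ N /2⌉ ℤ.≤ l → l ℤ.≤ ℤ.+ (n ∸ ⌊ N /2⌋) → ∃ λ t → ℤ.+ f (N ↑ʳ t) ≡ l
    onto .(ℤ.+ l) (ℤ.+≤+ {n = l} lo) (ℤ.+≤+ hi) with zigzag-tail-onto N≤n lo hi
    ... | q , N≤q , q≤n , label-q with new-at q N≤q q≤n
    ...   | t , pos-t = t , cong ℤ.+_ (trans (cong (zigzag n) pos-t) label-q)

  alternating-and-transferable : ∃₂ λ a b → IsAlternating f (λ i → vs i ↑ˡ k) a b
                                       × IsTransferable T' f (vs zero ↑ˡ k) (λ t → N ↑ʳ t) a b
  alternating-and-transferable with zigzag-alternates n p (≤-trans (m≤m+n p 0) (subst (_≤ n) (pos-listed zero) (pos≤n _)))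
  ... | a , b , alternates , window-sum =
    a , b , listed-alternate alternates , (Finₚ.↑ʳ-injective N _ _) , new-leaf , transfer (k ≟ 0)
    where
    transfer : Dec (k ≡ 0) → k ≡ 0 ⊎ (∃₂ λ c d → c ℤ.≤ d × c ℤ.+ d ≡ a ℤ.+ b × LabelWindow c d)
    transfer (yes k≡0) = inj₁ k≡0
    transfer (no k≢0)  = inj₂ (ℤ.+ ⌈ N /2⌉ , ℤ.+ (n ∸ ⌊ N /2⌋) , ℤ.+≤+ (≤-trans lo hi) ,
                               sym (window-sum N N+p-odd N≤n) , attached-window N≤n)
      where
      N≤n : N ≤ n
      N≤n = <⇒≤pred (m<m+n N (n≢0⇒n>0 k≢0))
      lo : ⌈ N /2⌉ ≤ zigzag n N
      lo = proj₁ (zigzag-tail-range {n} {N} {N} ≤-refl N≤n)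
      hi : zigzag n N ≤ n ∸ ⌊ N /2⌋
      hi = proj₂ (zigzag-tail-range {n} {N} {N} ≤-refl N≤n)

mainTheorem13 : (T : RTree) → IsTree T → IsOddRadial T →
    (rk : Fin (size T) → Fin (size T)) → IsLexOrder T rk →
    (m : ℕ) (vs : Fin (suc m) → Fin (size T)) → IsLeafListing T rk vs →
    (k : ℕ) →
    ∃ λ (f : Fin (size T + k) → ℕ) →
      IsGraceful (attach T (vs zero) k) f
      × f (root T ↑ˡ k) ≡ 0
      × ∃₂ λ a b →
          IsAlternating f (λ i → vs i ↑ˡ k) a b
          × IsTransferable (attach T (vs zero) k) f (vs zero ↑ˡ k) (λ j → size T ↑ʳ j) a b
mainTheorem13 T isTree oddRadial rk lex m vs listing k =
  f , graceful , f-root , alternating-and-transferable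
  where open Attached T isTree oddRadial rk lex m vs listing k
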